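{- For $n\geqslant 5$, $T(F_n;x,y)=T(F_{n-1}^+;x,y)$ but $Q(F_n;x,y)\neq Q(F_{n-1}^+;x,y)$.
   Context: All graphs are simple and finite. For a graph $G=(V,E)$, $k(G)$ denotes the number of connected components of $G$, $G[X]$ the subgraph induced by $X\subseteq V$, and the subgraph component polynomial is $Q(G;x,y)=\sum_{X\subseteq V} x^{|X|}y^{k(G[X])}$. $T(G;x,y)$ denotes the Tutte polynomial of $G$. $P_n$ denotes the path on $n$ vertices. The fan graph $F_n$ is the join $K_1\vee P_n$: its path vertices are labeled $v_1,\dots,v_n$ in path order (so $v_i v_{i+1}$ are edges) and the central vertex is $v_0$, adjacent to all of $v_1,\dots,v_n$. The graph $F_{n-1}^+$ is obtained from the fan $F_{n-1}$ (central vertex $v_0$, path $v_1,\dots,v_{n-1}$) by adding a new vertex $v_n$ and the two new edges $\{v_{n-2},v_n\}$ and $\{v_{n-1},v_n\}$. -}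

module Defs where

open import Data.Bool using (Bool; true; false; _∧_; _∨_; not; if_then_else_)
open import Data.Nat using (ℕ; zero; suc; _∸_; _≡ᵇ_; _<ᵇ_)
open import Data.Nat.Combinatorics using (_C_)
open import Data.Integer as ℤ using (ℤ; +_)
open import Data.List using (List; []; _∷_; _++_; map; filter; length; upTo; foldr)
open import Data.Bool.ListAction using (any)
open import Data.Product using (_×_; _,_)
open import Relation.Nullary.Decidable using (Dec)
open import Data.Bool.Properties using (T?)

-- Finite simple graphs: vertex set {0,…,nV-1}, edge list of unordered
-- pairs (each stored once as an ordered pair).

record Graph : Set where
  constructor mkGraph
  field
    nV : ℕ
    E  : List (ℕ × ℕ)
open Graph public

-- all sublists (= all subsets of a duplicate-free list)
sublists : {A : Set} → List A → List (List A)
sublists []       = [] ∷ []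
sublists (x ∷ xs) = sublists xs ++ map (x ∷_) (sublists xs)

count : {A : Set} → (A → Bool) → List A → ℕ
count p xs = length (filter (λ a → T? (p a)) xs)

adj : List (ℕ × ℕ) → ℕ → ℕ → Bool
adj es u w = any (λ { (a , b) → ((a ≡ᵇ u) ∧ (b ≡ᵇ w)) ∨ ((a ≡ᵇ w) ∧ (b ≡ᵇ u)) }) es

reach : ℕ → List ℕ → List (ℕ × ℕ) → ℕ → ℕ → Bool
reach zero    X es u v = u ≡ᵇ v
reach (suc f) X es u v = (u ≡ᵇ v) ∨ any (λ w → adj es u w ∧ reach f X es w v) X

-- number of connected components of the graph (X, es restricted to X):
-- each component is counted once, via its least vertex.
-- (walks of length ≤ |X| suffice for connectivity in a graph on X)
ncomp : List ℕ → List (ℕ × ℕ) → ℕ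
ncomp X es = count (λ v → not (any (λ u → (u <ᵇ v) ∧ reach (length X) X es v u) X)) X

vertices : Graph → List ℕ
vertices G = upTo (nV G)

kInduced : Graph → List ℕ → ℕ
kInduced G X = ncomp X (E G)

-- Subgraph component polynomial Q(G;x,y) = Σ_X x^|X| y^k(G[X]),
-- given by its coefficient of x^i y^j.

Qcoef : Graph → ℕ → ℕ → ℕ
Qcoef G i j = count (λ X → (length X ≡ᵇ i) ∧ (kInduced G X ≡ᵇ j)) (sublists (vertices G))

-- Tutte polynomial T(G;x,y) = Σ_{A⊆E} (x-1)^{r(E)-r(A)} (y-1)^{|A|-r(A)},
-- r(A) = |V| - k(V,A), given by its coefficient of x^i y^j.

rank : Graph → List (ℕ × ℕ) → ℕ
rank G A = nV G ∸ ncomp (vertices G) A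

sgn : ℕ → ℤ
sgn zero          = ℤ.+ 1
sgn (suc zero)    = ℤ.- (ℤ.+ 1)
sgn (suc (suc k)) = sgn k

coefPowMinusOne : ℕ → ℕ → ℤ
coefPowMinusOne a i = sgn (a ∸ i) ℤ.* (+ (a C i))

sumℤ : List ℤ → ℤ
sumℤ = foldr ℤ._+_ (+ 0)

Tcoef : Graph → ℕ → ℕ → ℤ
Tcoef G i j = sumℤ (map (λ A → coefPowMinusOne (rank G (E G) ∸ rank G A) i
                               ℤ.* coefPowMinusOne (length A ∸ rank G A) j)
                        (sublists (E G)))

-- Fan F_n = K_1 ∨ P_n: central vertex 0, path vertices 1,…,n.

fanEdges : ℕ → List (ℕ × ℕ)
fanEdges n = map (λ i → (0 , suc i)) (upTo n)
          ++ map (λ i → (suc i , suc (suc i))) (upTo (n ∸ 1))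

fan : ℕ → Graph
fan n = mkGraph (suc n) (fanEdges n)

-- F_{n-1}^+ : F_{n-1} plus vertex n and edges {n-2,n}, {n-1,n}
fanPlus : ℕ → Graph
fanPlus n = mkGraph (suc n) (fanEdges (n ∸ 1) ++ ((n ∸ 2 , n) ∷ (n ∸ 1 , n) ∷ []))

module Submission where

-- Write c = n-2, a = n-1, b = n.  Both edge sets are, up to order,
-- the edges of the smaller fan F_c together with an "ear" on the new vertices
-- a, b: in F_n the ear is attached at (0, c), in F_{n-1}^+ at (c, 0) (a Whitney
-- twist).  The key lemma `Twist.twist` shows that for any edge set B on the
-- vertices 0,…,c and any subset of the ear, exchanging the two attachment
-- vertices does not change the number of components; it is proved vertex by
-- vertex through the least-vertex description of `ncomp`, using that `reach`
-- decides connectivity.  Matching subsets position by position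
-- (`ΣS-positions`) then gives equal rank-size terms, hence equal Tutte
-- coefficients, after reordering the edge lists (`ΣS-↭`).
--
-- The coefficient of x³y³ counts independent 3-sets.  Every independent
-- 3-set of F_{n-1}^+ is independent in F_n (the only edge of F_n missing from
-- F_{n-1}^+ is 0b, and 0 is adjacent in F_{n-1}^+ to all vertices below b),
-- while {1, n-2, n} is independent in F_n only.

open import Defs
open import Data.Bool using (Bool; true; false; _∧_; _∨_; not; if_then_else_)
open import Data.Bool.Properties using (∨-zeroʳ; ∨-assoc; ∨-comm)
open import Data.Bool.ListAction using (any)
open import Data.Nat using (ℕ; zero; suc; _∸_; _≤_; _<_; _≡ᵇ_; _<ᵇ_; z≤n; s≤s; _≟_)
open import Data.Nat.Properties
open import Data.Integer as ℤ using (ℤ; +_)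
import Data.Integer.Properties as ℤ
open import Algebra.Properties.CommutativeSemigroup ℤ.+-commutativeSemigroup using (interchange)
open import Data.Product using (_×_; _,_; proj₁; proj₂; ∃-syntax)
open import Data.Sum using (_⊎_; inj₁; inj₂)
open import Data.Empty using (⊥; ⊥-elim)
open import Data.List using (List; []; _∷_; _++_; map; length; upTo; replicate)
open import Data.List.Properties using (length-++-sucʳ; map-++; map-∘; map-cong; upTo-∷ʳ)
import Data.List.Properties as List
open import Data.List.Relation.Unary.All using ([]; _∷_)
open import Data.List.Relation.Unary.All.Properties using (¬Any⇒All¬; All¬⇒¬Any)
open import Data.List.Relation.Unary.Any using (here; there)
open import Data.List.Relation.Unary.Unique.Propositional using (Unique; []; _∷_)
open import Data.List.Membership.Propositional using (_∈_; _∉_)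
open import Data.List.Membership.Propositional.Properties using (∈-upTo⁺; ∈-upTo⁻; ∈-∃++; ∈-map⁺; ∈-map⁻; ∈-++⁻; ∈-++⁺ˡ; ∈-++⁺ʳ)
import Data.List.Relation.Unary.All as All
open import Data.List.Membership.DecPropositional _≟_ using (_∈?_)
import Data.List.Relation.Binary.Permutation.Propositional as ↭
import Data.List.Relation.Binary.Permutation.Propositional.Properties as Perm
open ↭ using (_↭_)
open import Relation.Nullary using (¬_; yes; no)
open import Relation.Binary.PropositionalEquality
open import Relation.Binary.Definitions using (tri<; tri≈; tri>)
open import Function using (_∘_)
open import Data.List.Relation.Unary.Unique.Propositional.Properties using (upTo⁺)
open import Data.List.Relation.Binary.Sublist.Propositional using (_⊆_; []; _∷_; _∷ʳ_; from∈)
import Data.List.Relation.Binary.Sublist.Propositional.Properties as Sublist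

≡ᵇ⇒≡′ : ∀ m n → (m ≡ᵇ n) ≡ true → m ≡ n
≡ᵇ⇒≡′ zero    zero    _ = refl
≡ᵇ⇒≡′ (suc m) (suc n) e = cong suc (≡ᵇ⇒≡′ m n e)

≡ᵇ-refl : ∀ m → (m ≡ᵇ m) ≡ true
≡ᵇ-refl zero    = refl
≡ᵇ-refl (suc m) = ≡ᵇ-refl m

≢⇒≡ᵇ-false : ∀ m n → m ≢ n → (m ≡ᵇ n) ≡ false
≢⇒≡ᵇ-false m n m≢n with m ≡ᵇ n in e
... | true  = ⊥-elim (m≢n (≡ᵇ⇒≡′ m n e))
... | false = refl

<ᵇ⇒<′ : ∀ m n → (m <ᵇ n) ≡ true → m < n
<ᵇ⇒<′ zero    (suc n) _ = s≤s z≤n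
<ᵇ⇒<′ (suc m) (suc n) e = s≤s (<ᵇ⇒<′ m n e)

<⇒<ᵇ′ : ∀ {m n} → m < n → (m <ᵇ n) ≡ true
<⇒<ᵇ′ {zero}  {suc n} _         = refl
<⇒<ᵇ′ {suc m} {suc n} (s≤s m<n) = <⇒<ᵇ′ m<n

∨-true : ∀ x y → x ∨ y ≡ true → x ≡ true ⊎ y ≡ true
∨-true true  _ _ = inj₁ refl
∨-true false _ e = inj₂ e

∧-true : ∀ x y → x ∧ y ≡ true → x ≡ true × y ≡ true
∧-true true true _ = refl , refl

bit-clash : ∀ {x : Bool} → x ≡ true → x ≡ false → ⊥
bit-clash refl ()

not-false : ∀ {x : Bool} → (x ≡ false → ⊥) → x ≡ true
not-false {true}  _ = refl
not-false {false} f = ⊥-elim (f refl)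

not-true : ∀ {x : Bool} → (x ≡ true → ⊥) → x ≡ false
not-true {true}  f = ⊥-elim (f refl)
not-true {false} _ = refl

∨-false : ∀ x y → x ∨ y ≡ false → x ≡ false × y ≡ false
∨-false false false _ = refl , refl

true-iff : ∀ {x y : Bool} → (x ≡ true → y ≡ true) → (y ≡ true → x ≡ true) → x ≡ y
true-iff {true}  {true}  _ _ = refl
true-iff {true}  {false} f _ = sym (f refl)
true-iff {false} {true}  _ g = g refl
true-iff {false} {false} _ _ = refl

module _ {A : Set} where

  any-∈ : ∀ (p : A → Bool) {x xs} → x ∈ xs → p x ≡ true → any p xs ≡ true
  any-∈ p {xs = y ∷ _} (here refl) px rewrite px = refl
  any-∈ p {xs = y ∷ _} (there x∈) px rewrite any-∈ p x∈ px = ∨-zeroʳ (p y)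

  any-witness : ∀ (p : A → Bool) xs → any p xs ≡ true → ∃[ x ] (x ∈ xs × p x ≡ true)
  any-witness p (y ∷ xs) e with ∨-true (p y) (any p xs) e
  ... | inj₁ py = y , here refl , py
  ... | inj₂ rest with any-witness p xs rest
  ...   | x , x∈ , px = x , there x∈ , px

  any-false : ∀ (p : A → Bool) xs → (∀ x → x ∈ xs → p x ≡ false) → any p xs ≡ false
  any-false p []       _ = refl
  any-false p (y ∷ xs) h rewrite h y (here refl) = any-false p xs (λ x x∈ → h x (there x∈))

  any-cong : ∀ (p q : A → Bool) xs → (∀ x → x ∈ xs → p x ≡ q x) → any p xs ≡ any q xs
  any-cong p q []       _ = refl
  any-cong p q (y ∷ xs) h = cong₂ _∨_ (h y (here refl)) (any-cong p q xs (λ x x∈ → h x (there x∈)))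

  any-++ : ∀ (p : A → Bool) xs ys → any p (xs ++ ys) ≡ any p xs ∨ any p ys
  any-++ p []       ys = refl
  any-++ p (x ∷ xs) ys rewrite any-++ p xs ys = sym (∨-assoc (p x) (any p xs) (any p ys))

  count-cong : ∀ (p q : A → Bool) xs → (∀ x → x ∈ xs → p x ≡ q x) → count p xs ≡ count q xs
  count-cong p q []       _ = refl
  count-cong p q (y ∷ xs) h with p y | q y | h y (here refl)
  ... | true  | true  | refl = cong suc (count-cong p q xs (λ x x∈ → h x (there x∈)))
  ... | false | false | refl = count-cong p q xs (λ x x∈ → h x (there x∈))

  count-all : ∀ (p : A → Bool) xs → (∀ x → x ∈ xs → p x ≡ true) → count p xs ≡ length xs
  count-all p []       _ = refl
  count-all p (y ∷ xs) h with p y | h y (here refl)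
  ... | true | refl = cong suc (count-all p xs (λ x x∈ → h x (there x∈)))

  count-≤ : ∀ (p : A → Bool) xs → count p xs ≤ length xs
  count-≤ p []       = z≤n
  count-≤ p (y ∷ xs) with p y
  ... | true  = s≤s (count-≤ p xs)
  ... | false = m≤n⇒m≤1+n (count-≤ p xs)

  count-< : ∀ (p : A → Bool) xs {x} → x ∈ xs → p x ≡ false → count p xs < length xs
  count-< p (y ∷ xs) (here refl) py rewrite py = s≤s (count-≤ p xs)
  count-< p (y ∷ xs) (there x∈) px with p y
  ... | true  = s≤s (count-< p xs x∈ px)
  ... | false = m≤n⇒m≤1+n (count-< p xs x∈ px)

  count-mono : ∀ (p q : A → Bool) xs → (∀ y → y ∈ xs → p y ≡ true → q y ≡ true) →
               count p xs ≤ count q xs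
  count-mono p q []       _   = z≤n
  count-mono p q (y ∷ xs) p⇒q with p y in py | q y in qy
  ... | true  | true  = s≤s (count-mono p q xs (λ z z∈ → p⇒q z (there z∈)))
  ... | true  | false with () ← trans (sym (p⇒q y (here refl) py)) qy
  ... | false | true  = m≤n⇒m≤1+n (count-mono p q xs (λ z z∈ → p⇒q z (there z∈)))
  ... | false | false = count-mono p q xs (λ z z∈ → p⇒q z (there z∈))

  count-mono-< : ∀ (p q : A → Bool) xs {x} → (∀ y → y ∈ xs → p y ≡ true → q y ≡ true) →
                 x ∈ xs → p x ≡ false → q x ≡ true → count p xs < count q xs
  count-mono-< p q (y ∷ xs) p⇒q (here refl) px qx rewrite px | qx =
    s≤s (count-mono p q xs (λ z z∈ → p⇒q z (there z∈)))
  count-mono-< p q (y ∷ xs) p⇒q (there x∈) px qx with p y in py | q y in qy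
  ... | true  | true  = s≤s (count-mono-< p q xs (λ z z∈ → p⇒q z (there z∈)) x∈ px qx)
  ... | true  | false with () ← trans (sym (p⇒q y (here refl) py)) qy
  ... | false | true  = m≤n⇒m≤1+n (count-mono-< p q xs (λ z z∈ → p⇒q z (there z∈)) x∈ px qx)
  ... | false | false = count-mono-< p q xs (λ z z∈ → p⇒q z (there z∈)) x∈ px qx

  any-↭ : ∀ (p : A → Bool) {xs ys} → xs ↭ ys → any p xs ≡ any p ys
  any-↭ p ↭.refl           = refl
  any-↭ p (↭.prep x xs↭ys) = cong (p x ∨_) (any-↭ p xs↭ys)
  any-↭ p {x ∷ y ∷ xs} {y ∷ x ∷ ys} (↭.swap x y xs↭ys) = begin
    p x ∨ (p y ∨ any p xs)  ≡⟨ sym (∨-assoc (p x) (p y) _) ⟩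
    (p x ∨ p y) ∨ any p xs  ≡⟨ cong₂ _∨_ (∨-comm (p x) (p y)) (any-↭ p xs↭ys) ⟩
    (p y ∨ p x) ∨ any p ys  ≡⟨ ∨-assoc (p y) (p x) _ ⟩
    p y ∨ (p x ∨ any p ys)  ∎
    where open ≡-Reasoning
  any-↭ p (↭.trans p₁ p₂)  = trans (any-↭ p p₁) (any-↭ p p₂)

joinsᵇ : ℕ → ℕ → ℕ × ℕ → Bool
joinsᵇ u w (x , y) = ((x ≡ᵇ u) ∧ (y ≡ᵇ w)) ∨ ((x ≡ᵇ w) ∧ (y ≡ᵇ u))

Joins : ℕ × ℕ → ℕ → ℕ → Set
Joins (x , y) u w = (x ≡ u × y ≡ w) ⊎ (x ≡ w × y ≡ u)

joins-sym : ∀ {e u w} → Joins e u w → Joins e w u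
joins-sym (inj₁ eq) = inj₂ eq
joins-sym (inj₂ eq) = inj₁ eq

joinsᵇ-true : ∀ e u w → Joins e u w → joinsᵇ u w e ≡ true
joinsᵇ-true (u , w) u w (inj₁ (refl , refl)) rewrite ≡ᵇ-refl u | ≡ᵇ-refl w = refl
joinsᵇ-true (w , u) u w (inj₂ (refl , refl)) rewrite ≡ᵇ-refl u | ≡ᵇ-refl w = ∨-zeroʳ _

joinsᵇ-sound : ∀ e u w → joinsᵇ u w e ≡ true → Joins e u w
joinsᵇ-sound (x , y) u w h with ∨-true ((x ≡ᵇ u) ∧ (y ≡ᵇ w)) _ h
... | inj₁ h₁ = inj₁ (≡ᵇ⇒≡′ x u (proj₁ (∧-true _ _ h₁)) , ≡ᵇ⇒≡′ y w (proj₂ (∧-true _ _ h₁)))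
... | inj₂ h₂ = inj₂ (≡ᵇ⇒≡′ x w (proj₁ (∧-true _ _ h₂)) , ≡ᵇ⇒≡′ y u (proj₂ (∧-true _ _ h₂)))

joinsᵇ-reverse : ∀ x z u w → joinsᵇ u w (x , z) ≡ joinsᵇ u w (z , x)
joinsᵇ-reverse x z u w = true-iff (reverse x z) (reverse z x)
  where
  reverse : ∀ x z → joinsᵇ u w (x , z) ≡ true → joinsᵇ u w (z , x) ≡ true
  reverse x z h with joinsᵇ-sound (x , z) u w h
  ... | inj₁ (x≡u , z≡w) = joinsᵇ-true (z , x) u w (inj₂ (z≡w , x≡u))
  ... | inj₂ (x≡w , z≡u) = joinsᵇ-true (z , x) u w (inj₁ (z≡u , x≡w))

adj-joins : ∀ es {e u w} → e ∈ es → Joins e u w → adj es u w ≡ true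
adj-joins es {e} {u} {w} e∈ j = any-∈ (joinsᵇ u w) e∈ (joinsᵇ-true e u w j)

adj-∈ : ∀ es {u w} → (u , w) ∈ es → adj es u w ≡ true
adj-∈ es e∈ = adj-joins es e∈ (inj₁ (refl , refl))

adj-∈ʳ : ∀ es {u w} → (w , u) ∈ es → adj es u w ≡ true
adj-∈ʳ es e∈ = adj-joins es e∈ (inj₂ (refl , refl))

adj-edge : ∀ es u w → adj es u w ≡ true → ∃[ e ] (e ∈ es × Joins e u w)
adj-edge es u w h with any-witness (joinsᵇ u w) es h
... | e , e∈ , j = e , e∈ , joinsᵇ-sound e u w j

adj-sym : ∀ es u w → adj es u w ≡ adj es w u
adj-sym es u w = true-iff (flip u w) (flip w u)
  where
  flip : ∀ u w → adj es u w ≡ true → adj es w u ≡ true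
  flip u w h with adj-edge es u w h
  ... | e , e∈ , j = adj-joins es e∈ (joins-sym j)

adj-++ : ∀ es es′ u w → adj (es ++ es′) u w ≡ adj es u w ∨ adj es′ u w
adj-++ es es′ u w = any-++ (joinsᵇ u w) es es′

adj-↭ : ∀ {es es′} → es ↭ es′ → ∀ u w → adj es u w ≡ adj es′ u w
adj-↭ es↭es′ u w = any-↭ (joinsᵇ u w) es↭es′

adj-irrefl : ∀ es → (∀ e → e ∈ es → proj₁ e < proj₂ e) → ∀ u → adj es u u ≡ false
adj-irrefl es up u with adj es u u in h
... | false = refl
... | true with adj-edge es u u h
...   | _ , e∈ , inj₁ (refl , refl) = ⊥-elim (<-irrefl refl (up _ e∈))
...   | _ , e∈ , inj₂ (refl , refl) = ⊥-elim (<-irrefl refl (up _ e∈))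

data Conn (A : ℕ → ℕ → Bool) (X : List ℕ) : ℕ → ℕ → Set where
  done : ∀ {u} → Conn A X u u
  step : ∀ {u w v} → w ∈ X → A u w ≡ true → Conn A X w v → Conn A X u v

module _ {A : ℕ → ℕ → Bool} {X : List ℕ} where

  single : ∀ {u w} → w ∈ X → A u w ≡ true → Conn A X u w
  single w∈ a = step w∈ a done

  conn-trans : ∀ {u v w} → Conn A X u v → Conn A X v w → Conn A X u w
  conn-trans done             c = c
  conn-trans (step w∈ a c₁) c₂ = step w∈ a (conn-trans c₁ c₂)

  conn-invariant : (P : ℕ → Set) → (∀ y w → w ∈ X → A y w ≡ true → P y → P w) →
                   ∀ {u v} → Conn A X u v → P u → P v
  conn-invariant P keep done          pu = pu
  conn-invariant P keep (step w∈ a c) pu = conn-invariant P keep c (keep _ _ w∈ a pu)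

conn-map : ∀ {A A′ X} → (∀ y w → w ∈ X → A y w ≡ true → Conn A′ X y w) →
           ∀ {u v} → Conn A X u v → Conn A′ X u v
conn-map f done          = done
conn-map f (step w∈ a c) = conn-trans (f _ _ w∈ a) (conn-map f c)

reach-sound : ∀ f X es u v → reach f X es u v ≡ true → Conn (adj es) X u v
reach-sound zero    X es u v h rewrite ≡ᵇ⇒≡′ u v h = done
reach-sound (suc f) X es u v h with ∨-true (u ≡ᵇ v) _ h
... | inj₁ u≡v rewrite ≡ᵇ⇒≡′ u v u≡v = done
... | inj₂ h′ with any-witness _ X h′
...   | w , w∈ , hw = step w∈ (proj₁ (∧-true _ _ hw)) (reach-sound f X es w v (proj₂ (∧-true _ _ hw)))

data Walk (A : ℕ → ℕ → Bool) (X : List ℕ) : ℕ → ℕ → List ℕ → Set where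
  done : ∀ {u} → Walk A X u u []
  step : ∀ {u w v L} → w ∈ X → A u w ≡ true → Walk A X w v L → Walk A X u v (w ∷ L)

module _ {A : ℕ → ℕ → Bool} {X : List ℕ} where

  conn⇒walk : ∀ {u v} → Conn A X u v → ∃[ L ] Walk A X u v L
  conn⇒walk done = [] , done
  conn⇒walk (step w∈ a c) with conn⇒walk c
  ... | L , wk = _ ∷ L , step w∈ a wk

  walk-⊆ : ∀ {u v L} → Walk A X u v L → ∀ z → z ∈ L → z ∈ X
  walk-⊆ (step w∈ _ _)  z (here refl) = w∈
  walk-⊆ (step _ _ wk) z (there z∈)  = walk-⊆ wk z z∈

  walk-from : ∀ {x v L y} → Walk A X x v L → Unique L → y ∈ L →
              ∃[ L′ ] (Walk A X y v L′ × Unique L′ × y ∉ L′)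
  walk-from (step _ _ wk) (y∉ ∷ uL) (here refl) = _ , wk , uL , All¬⇒¬Any y∉
  walk-from (step _ _ wk) (_ ∷ uL)  (there y∈)  = walk-from wk uL y∈

  walk-unique : ∀ {u v L} → Walk A X u v L → ∃[ L′ ] (Walk A X u v L′ × Unique L′)
  walk-unique done = [] , done , []
  walk-unique (step {w = w} w∈ a wk) with walk-unique wk
  ... | L′ , wk′ , uL′ with w ∈? L′
  ...   | no w∉  = w ∷ L′ , step w∈ a wk′ , ¬Any⇒All¬ L′ w∉ ∷ uL′
  ...   | yes w∈L′ with walk-from wk′ uL′ w∈L′
  ...     | L″ , wk″ , uL″ , w∉ = w ∷ L″ , step w∈ a wk″ , ¬Any⇒All¬ L″ w∉ ∷ uL″

unique-length-≤ : ∀ {L X : List ℕ} → Unique L → (∀ z → z ∈ L → z ∈ X) → length L ≤ length X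
unique-length-≤ {[]}    _           _    = z≤n
unique-length-≤ {x ∷ L} {X} (x∉L ∷ uL) L⊆X with ∈-∃++ (L⊆X x (here refl))
... | ys , zs , refl =
  ≤-trans (s≤s (unique-length-≤ uL L⊆rest)) (≤-reflexive (sym (length-++-sucʳ ys x zs)))
  where
  L⊆rest : ∀ z → z ∈ L → z ∈ ys ++ zs
  L⊆rest z z∈ with ∈-++⁻ ys (L⊆X z (there z∈))
  ... | inj₁ z∈ys             = ∈-++⁺ˡ z∈ys
  ... | inj₂ (here refl)      = ⊥-elim (All.lookup x∉L z∈ refl)
  ... | inj₂ (there z∈zs)     = ∈-++⁺ʳ ys z∈zs

walk⇒reach : ∀ {X es u v L} f → Walk (adj es) X u v L → length L ≤ f → reach f X es u v ≡ true
walk⇒reach {u = u} zero    done _ = ≡ᵇ-refl u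
walk⇒reach {u = u} (suc f) done _ rewrite ≡ᵇ-refl u = refl
walk⇒reach {u = u} {v} (suc f) (step w∈ a wk) (s≤s len) =
  trans (cong ((u ≡ᵇ v) ∨_) (any-∈ _ w∈ (cong₂ _∧_ a (walk⇒reach f wk len)))) (∨-zeroʳ _)

conn⇒reach : ∀ X es {u v} → Conn (adj es) X u v → reach (length X) X es u v ≡ true
conn⇒reach X es c with conn⇒walk c
... | _ , wk with walk-unique wk
...   | _ , wk′ , uL = walk⇒reach (length X) wk′ (unique-length-≤ uL (walk-⊆ wk′))

reach⇒conn : ∀ X es u v → reach (length X) X es u v ≡ true → Conn (adj es) X u v
reach⇒conn X es u v = reach-sound (length X) X es u v

belowTest : List ℕ → List (ℕ × ℕ) → ℕ → ℕ → Bool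
belowTest X es v u = (u <ᵇ v) ∧ reach (length X) X es v u

joinedBelow : List ℕ → List (ℕ × ℕ) → ℕ → Bool
joinedBelow X es v = any (belowTest X es v) X

ncomp-cong : ∀ X es es′ → (∀ v → v ∈ X → joinedBelow X es v ≡ joinedBelow X es′ v) →
             ncomp X es ≡ ncomp X es′
ncomp-cong X es es′ same = count-cong _ _ X (λ v v∈ → cong not (same v v∈))

reach-adj-cong : ∀ f X {es es′} → (∀ u w → adj es u w ≡ adj es′ u w) →
                 ∀ u v → reach f X es u v ≡ reach f X es′ u v
reach-adj-cong zero    X same u v = refl
reach-adj-cong (suc f) X same u v =
  cong ((u ≡ᵇ v) ∨_) (any-cong _ _ X (λ w _ → cong₂ _∧_ (same u w) (reach-adj-cong f X same w v)))

-- The component count only depends on the edge list through adjacency,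
-- so in particular not on the order of the edges.
ncomp-↭ : ∀ X es es′ → es ↭ es′ → ncomp X es ≡ ncomp X es′
ncomp-↭ X es es′ es↭es′ = ncomp-cong X es es′ (λ v _ →
  any-cong _ _ X (λ u _ → cong ((u <ᵇ v) ∧_) (reach-adj-cong (length X) X (adj-↭ es↭es′) v u)))

ncomp-independent : ∀ X es → (∀ u w → u ∈ X → w ∈ X → adj es u w ≡ false) → ncomp X es ≡ length X
ncomp-independent X es noEdge = count-all _ X (λ v v∈ → cong not (any-false _ X (λ u _ → below-false v u v∈)))
  where
  below-false : ∀ v u → v ∈ X → (u <ᵇ v) ∧ reach (length X) X es v u ≡ false
  below-false v u v∈ with u <ᵇ v in u<v | reach (length X) X es v u in r
  ... | false | _     = refl
  ... | true  | false = refl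
  ... | true  | true  = ⊥-elim (<-irrefl (sym stuck) (<ᵇ⇒<′ u v u<v))
    where
    stuck : v ≡ u
    stuck = conn-invariant (v ≡_) blocked (reach⇒conn X es v u r) refl
      where
      blocked : ∀ y w → w ∈ X → adj es y w ≡ true → v ≡ y → v ≡ w
      blocked y w w∈ a refl with () ← trans (sym a) (noEdge v w v∈ w∈)

-- An edge from u down to a smaller vertex w of X makes u `joinedBelow`, so an
-- edge between two distinct vertices of X merges two components.
ncomp-edge-<′ : ∀ X es {u w} → u ∈ X → w ∈ X → w < u → adj es u w ≡ true → ncomp X es < length X
ncomp-edge-<′ X es u∈ w∈ w<u a = count-< _ X u∈ (cong not joined)
  where
  joined : joinedBelow X es _ ≡ true
  joined = any-∈ _ w∈ (cong₂ _∧_ (<⇒<ᵇ′ w<u) (conn⇒reach X es (single w∈ a)))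

ncomp-edge-< : ∀ X es {u w} → u ∈ X → w ∈ X → u ≢ w → adj es u w ≡ true → ncomp X es < length X
ncomp-edge-< X es {u} {w} u∈ w∈ u≢w a with <-cmp u w
... | tri< u<w _ _ = ncomp-edge-<′ X es w∈ u∈ u<w (trans (adj-sym es w u) a)
... | tri≈ _ u≡w _ = ⊥-elim (u≢w u≡w)
... | tri> _ _ w<u = ncomp-edge-<′ X es u∈ w∈ w<u a

-- Moving `ncomp` along equations of its arguments.  All four lists are
-- explicit so that the type checker never has to compare (and unfold) two
-- component counts.
ncomp-at : ∀ X X′ es es′ → X ≡ X′ → es ≡ es′ → ncomp X es ≡ ncomp X′ es′
ncomp-at X X es es refl refl = refl

ΣS : {E : Set} → (List E → ℤ) → List E → ℤ
ΣS h L = sumℤ (map h (sublists L))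

sumℤ-++ : ∀ xs ys → sumℤ (xs ++ ys) ≡ sumℤ xs ℤ.+ sumℤ ys
sumℤ-++ []       ys = sym (ℤ.+-identityˡ (sumℤ ys))
sumℤ-++ (x ∷ xs) ys = trans (cong (ℤ._+_ x) (sumℤ-++ xs ys)) (sym (ℤ.+-assoc x (sumℤ xs) (sumℤ ys)))

module _ {E : Set} where

  ΣS-∷ : ∀ (h : List E → ℤ) x L → ΣS h (x ∷ L) ≡ ΣS h L ℤ.+ ΣS (λ A → h (x ∷ A)) L
  ΣS-∷ h x L = begin
    sumℤ (map h (sublists L ++ map (x ∷_) (sublists L)))
      ≡⟨ cong sumℤ (map-++ h (sublists L) _) ⟩
    sumℤ (map h (sublists L) ++ map h (map (x ∷_) (sublists L)))
      ≡⟨ sumℤ-++ (map h (sublists L)) _ ⟩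
    ΣS h L ℤ.+ sumℤ (map h (map (x ∷_) (sublists L)))
      ≡⟨ cong (λ l → ΣS h L ℤ.+ sumℤ l) (sym (map-∘ (sublists L))) ⟩
    ΣS h L ℤ.+ ΣS (λ A → h (x ∷ A)) L
      ∎
    where open ≡-Reasoning

  ΣS-cong : ∀ {h h′ : List E → ℤ} L → (∀ A → h A ≡ h′ A) → ΣS h L ≡ ΣS h′ L
  ΣS-cong L h≗h′ = cong sumℤ (map-cong h≗h′ (sublists L))

  PermInvariant : (List E → ℤ) → Set
  PermInvariant h = ∀ {A A′} → A ↭ A′ → h A ≡ h A′

  ΣS-↭ : ∀ (h : List E → ℤ) → PermInvariant h → ∀ {xs ys} → xs ↭ ys → ΣS h xs ≡ ΣS h ys
  ΣS-↭ h inv ↭.refl = refl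
  ΣS-↭ h inv {x ∷ xs} {x ∷ ys} (↭.prep x xs↭ys) = begin
    ΣS h (x ∷ xs)                       ≡⟨ ΣS-∷ h x xs ⟩
    ΣS h xs ℤ.+ ΣS (λ A → h (x ∷ A)) xs  ≡⟨ cong₂ ℤ._+_ (ΣS-↭ h inv xs↭ys)
                                              (ΣS-↭ _ (inv ∘ ↭.prep x) xs↭ys) ⟩
    ΣS h ys ℤ.+ ΣS (λ A → h (x ∷ A)) ys  ≡⟨ sym (ΣS-∷ h x ys) ⟩
    ΣS h (x ∷ ys)                       ∎
    where open ≡-Reasoning
  ΣS-↭ h inv {x ∷ y ∷ xs} {y ∷ x ∷ ys} (↭.swap x y xs↭ys) = begin
    ΣS h (x ∷ y ∷ xs)
      ≡⟨ trans (ΣS-∷ h x (y ∷ xs)) (cong₂ ℤ._+_ (ΣS-∷ h y xs) (ΣS-∷ _ y xs)) ⟩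
    (ΣS h xs ℤ.+ ΣS hy xs) ℤ.+ (ΣS hx xs ℤ.+ ΣS hxy xs)
      ≡⟨ interchange (ΣS h xs) _ _ _ ⟩
    (ΣS h xs ℤ.+ ΣS hx xs) ℤ.+ (ΣS hy xs ℤ.+ ΣS hxy xs)
      ≡⟨ cong₂ ℤ._+_ (cong₂ ℤ._+_ (ΣS-↭ h inv xs↭ys) (ΣS-↭ hx (inv ∘ ↭.prep x) xs↭ys))
                     (cong₂ ℤ._+_ (ΣS-↭ hy (inv ∘ ↭.prep y) xs↭ys)
                                  (trans (ΣS-↭ hxy (inv ∘ ↭.prep x ∘ ↭.prep y) xs↭ys)
                                         (ΣS-cong ys (λ A → inv (↭.swap x y ↭.refl))))) ⟩
    (ΣS h ys ℤ.+ ΣS hx ys) ℤ.+ (ΣS hy ys ℤ.+ ΣS hyx ys)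
      ≡⟨ sym (trans (ΣS-∷ h y (x ∷ ys)) (cong₂ ℤ._+_ (ΣS-∷ h x ys) (ΣS-∷ _ x ys))) ⟩
    ΣS h (y ∷ x ∷ ys)
      ∎
    where
    open ≡-Reasoning
    hx hy hxy hyx : List E → ℤ
    hx A = h (x ∷ A)
    hy A = h (y ∷ A)
    hxy A = h (x ∷ y ∷ A)
    hyx A = h (y ∷ x ∷ A)
  ΣS-↭ h inv (↭.trans p₁ p₂) = trans (ΣS-↭ h inv p₁) (ΣS-↭ h inv p₂)

-- Selecting a subset by a list of bits: the i-th element is kept iff the
-- i-th bit is set (missing bits count as unset).

headBit : List Bool → Bool
headBit []      = false
headBit (β ∷ _) = β

tailBits : List Bool → List Bool
tailBits []      = []
tailBits (_ ∷ β) = β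

dropBits : ℕ → List Bool → List Bool
dropBits zero    β = β
dropBits (suc n) β = dropBits n (tailBits β)

sel : {E : Set} → Bool → E → List E → List E
sel true  x L = x ∷ L
sel false x L = L

pick : {E : Set} → List Bool → List E → List E
pick β []       = []
pick β (x ∷ xs) = sel (headBit β) x (pick (tailBits β) xs)

module _ {E : Set} where

  ∈-sel : ∀ β (x : E) L {z} → z ∈ sel β x L → (β ≡ true × z ≡ x) ⊎ z ∈ L
  ∈-sel true  x L (here z≡x) = inj₁ (refl , z≡x)
  ∈-sel true  x L (there z∈) = inj₂ z∈
  ∈-sel false x L z∈         = inj₂ z∈

  sel-∈ : ∀ {β} (x : E) L → β ≡ true → x ∈ sel β x L
  sel-∈ x L refl = here refl

  sel-⊇ : ∀ β (x : E) {L z} → z ∈ L → z ∈ sel β x L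
  sel-⊇ true  x z∈ = there z∈
  sel-⊇ false x z∈ = z∈

  pick-⊆ : ∀ β (xs : List E) {z} → z ∈ pick β xs → z ∈ xs
  pick-⊆ β (x ∷ xs) z∈ with ∈-sel (headBit β) x _ z∈
  ... | inj₁ (_ , refl) = here refl
  ... | inj₂ z∈′        = there (pick-⊆ (tailBits β) xs z∈′)

  pick-length : ∀ β (xs ys : List E) → length xs ≡ length ys → length (pick β xs) ≡ length (pick β ys)
  pick-length β []       []       _   = refl
  pick-length β (x ∷ xs) (y ∷ ys) len with headBit β
  ... | true  = cong suc (pick-length (tailBits β) xs ys (suc-injective len))
  ... | false = pick-length (tailBits β) xs ys (suc-injective len)

  pick-++ : ∀ β (xs ys : List E) → pick β (xs ++ ys) ≡ pick β xs ++ pick (dropBits (length xs) β) ys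
  pick-++ β []       ys = refl
  pick-++ β (x ∷ xs) ys with headBit β
  ... | true  = cong (x ∷_) (pick-++ (tailBits β) xs ys)
  ... | false = pick-++ (tailBits β) xs ys

  pick-all : ∀ (xs : List E) → pick (replicate (length xs) true) xs ≡ xs
  pick-all []       = refl
  pick-all (x ∷ xs) = cong (x ∷_) (pick-all xs)

  pick-all′ : ∀ (xs ys : List E) → length xs ≡ length ys → pick (replicate (length xs) true) ys ≡ ys
  pick-all′ xs ys len rewrite len = pick-all ys

  ΣS-positions : ∀ (h h′ : List E → ℤ) xs ys → length xs ≡ length ys →
                 (∀ β → h (pick β xs) ≡ h′ (pick β ys)) → ΣS h xs ≡ ΣS h′ ys
  ΣS-positions h h′ []       []       _   same = cong (λ s → s ℤ.+ + 0) (same [])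
  ΣS-positions h h′ (x ∷ xs) (y ∷ ys) len same = begin
    ΣS h (x ∷ xs)                           ≡⟨ ΣS-∷ h x xs ⟩
    ΣS h xs ℤ.+ ΣS (λ A → h (x ∷ A)) xs      ≡⟨ cong₂ ℤ._+_
        (ΣS-positions h h′ xs ys (suc-injective len) (λ β → same (false ∷ β)))
        (ΣS-positions _ _ xs ys (suc-injective len) (λ β → same (true ∷ β))) ⟩
    ΣS h′ ys ℤ.+ ΣS (λ A → h′ (y ∷ A)) ys    ≡⟨ sym (ΣS-∷ h′ y ys) ⟩
    ΣS h′ (y ∷ ys)                          ∎
    where open ≡-Reasoning

-- The conditions on the bits β₁ … β₄ (selecting the ear edges pa, pb, qa, ab)
-- that decide connectivity through the ear.

-- The selected ear edges join p and q (through a, or through b and a).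
earJoins : Bool → Bool → Bool → Bool → Bool
earJoins β₁ β₂ β₃ β₄ = β₃ ∧ (β₁ ∨ (β₂ ∧ β₄))

-- The selected ear edges join a to p or q.
earReachesA : Bool → Bool → Bool → Bool → Bool
earReachesA β₁ β₂ β₃ β₄ = β₁ ∨ (β₃ ∨ (β₂ ∧ β₄))

earJoins-via-a : ∀ β₁ β₂ β₃ β₄ → β₁ ≡ true → β₃ ≡ true → earJoins β₁ β₂ β₃ β₄ ≡ true
earJoins-via-a true _ true _ _ _ = refl

earJoins-via-b : ∀ β₁ β₂ β₃ β₄ → β₂ ≡ true → β₃ ≡ true → β₄ ≡ true → earJoins β₁ β₂ β₃ β₄ ≡ true
earJoins-via-b β₁ true true true _ _ _ = ∨-zeroʳ β₁

earJoins-cases : ∀ β₁ β₂ β₃ β₄ → earJoins β₁ β₂ β₃ β₄ ≡ true →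
                 (β₁ ≡ true × β₃ ≡ true) ⊎ (β₂ ≡ true × β₃ ≡ true × β₄ ≡ true)
earJoins-cases true  _    true _    _ = inj₁ (refl , refl)
earJoins-cases false true true true _ = inj₂ (refl , refl , refl)

earReachesA-cases : ∀ β₁ β₂ β₃ β₄ → earReachesA β₁ β₂ β₃ β₄ ≡ true →
                    β₁ ≡ true ⊎ β₃ ≡ true ⊎ (β₂ ≡ true × β₄ ≡ true)
earReachesA-cases true  _    _     _    _ = inj₁ refl
earReachesA-cases false _    true  _    _ = inj₂ (inj₁ refl)
earReachesA-cases false true false true _ = inj₂ (inj₂ (refl , refl))

earReachesA-false : ∀ β₁ β₂ β₃ β₄ → earReachesA β₁ β₂ β₃ β₄ ≡ false →
                    β₁ ≡ false × β₃ ≡ false × (β₄ ≡ true → β₂ ≡ false)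
earReachesA-false false false false _     _ = refl , refl , λ _ → refl
earReachesA-false false true  false false _ = refl , refl , λ ()

if-cases : ∀ x {P : ℕ → Set} {u v} → (x ≡ true → P u) → (x ≡ false → P v) → P (if x then u else v)
if-cases true  t _ = t refl
if-cases false _ f = f refl

-- The ear attached at p and q to a graph on {0,…,c}: the new vertices are
-- a = c+1 and b = c+2, the edges pa, pb, qa and ab.

ear : ℕ → ℕ → ℕ → List (ℕ × ℕ)
ear c p q = (p , suc c) ∷ (p , suc (suc c)) ∷ (q , suc c) ∷ (suc c , suc (suc c)) ∷ []

-- Vertex by vertex: a low
-- vertex is joined below equally often since the ear only matters through
-- whether it joins p and q (a symmetric condition), while a and b are joined
-- below under conditions symmetric in p and q.

module Twist (c : ℕ) (B : List (ℕ × ℕ)) (B-low : ∀ e → e ∈ B → proj₁ e ≤ c × proj₂ e ≤ c) where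

  a b : ℕ
  a = suc c
  b = suc a

  V : List ℕ
  V = upTo (suc b)

  low∈V : ∀ {x} → x ≤ c → x ∈ V
  low∈V x≤c = ∈-upTo⁺ (s≤s (≤-trans x≤c (≤-trans (n≤1+n c) (n≤1+n a))))

  a∈V : a ∈ V
  a∈V = ∈-upTo⁺ (s≤s (n≤1+n a))

  b∈V : b ∈ V
  b∈V = ∈-upTo⁺ ≤-refl

  low≢a : ∀ {x} → x ≤ c → x ≢ a
  low≢a x≤c refl = 1+n≰n x≤c

  low≢b : ∀ {x} → x ≤ c → x ≢ b
  low≢b x≤c refl = 1+n≰n (≤-trans (n≤1+n a) x≤c)

  a≢b : a ≢ b
  a≢b a≡b = 1+n≢n (sym a≡b)

  B-adj-low : ∀ y w → adj B y w ≡ true → y ≤ c × w ≤ c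
  B-adj-low y w h with adj-edge B y w h
  ... | e , e∈ , inj₁ (refl , refl) = B-low e e∈
  ... | e , e∈ , inj₂ (refl , refl) = proj₂ (B-low e e∈) , proj₁ (B-low e e∈)

  -- The graph in which the ear is contracted to the possible edge pq.
  contracted : Bool → ℕ → ℕ → List (ℕ × ℕ)
  contracted m p q = B ++ sel m (p , q) []

  contracted-sym : ∀ m p q y w → adj (contracted m p q) y w ≡ adj (contracted m q p) y w
  contracted-sym false p q y w = refl
  contracted-sym true  p q y w =
    trans (adj-++ B _ y w) (trans (cong (adj B y w ∨_) flip) (sym (adj-++ B _ y w)))
    where
    flip : adj ((p , q) ∷ []) y w ≡ adj ((q , p) ∷ []) y w
    flip = cong (_∨ false) (joinsᵇ-reverse p q y w)

  module Attached (p q : ℕ) (p≤c : p ≤ c) (q≤c : q ≤ c) (β₁ β₂ β₃ β₄ : Bool) where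

    R : List (ℕ × ℕ)
    R = B ++ pick (β₁ ∷ β₂ ∷ β₃ ∷ β₄ ∷ []) (ear c p q)

    joined : Bool
    joined = earJoins β₁ β₂ β₃ β₄

    K : List (ℕ × ℕ)
    K = contracted joined p q

    data EarEdge : ℕ × ℕ → Set where
      pa : β₁ ≡ true → EarEdge (p , a)
      pb : β₂ ≡ true → EarEdge (p , b)
      qa : β₃ ≡ true → EarEdge (q , a)
      ab : β₄ ≡ true → EarEdge (a , b)

    ear-edge : ∀ {e} → e ∈ pick (β₁ ∷ β₂ ∷ β₃ ∷ β₄ ∷ []) (ear c p q) → EarEdge e
    ear-edge e∈ with ∈-sel β₁ _ _ e∈
    ... | inj₁ (h , refl) = pa h
    ... | inj₂ e∈₂ with ∈-sel β₂ _ _ e∈₂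
    ...   | inj₁ (h , refl) = pb h
    ...   | inj₂ e∈₃ with ∈-sel β₃ _ _ e∈₃
    ...     | inj₁ (h , refl) = qa h
    ...     | inj₂ e∈₄ with ∈-sel β₄ _ _ e∈₄
    ...       | inj₁ (h , refl) = ab h

    pa∈ : β₁ ≡ true → (p , a) ∈ R
    pa∈ h = ∈-++⁺ʳ B (sel-∈ _ _ h)
    pb∈ : β₂ ≡ true → (p , b) ∈ R
    pb∈ h = ∈-++⁺ʳ B (sel-⊇ β₁ _ (sel-∈ _ _ h))
    qa∈ : β₃ ≡ true → (q , a) ∈ R
    qa∈ h = ∈-++⁺ʳ B (sel-⊇ β₁ _ (sel-⊇ β₂ _ (sel-∈ _ _ h)))
    ab∈ : β₄ ≡ true → (a , b) ∈ R
    ab∈ h = ∈-++⁺ʳ B (sel-⊇ β₁ _ (sel-⊇ β₂ _ (sel-⊇ β₃ _ (sel-∈ _ _ h))))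

    R-edge : ∀ y w → adj R y w ≡ true → adj B y w ≡ true ⊎ ∃[ e ] (EarEdge e × Joins e y w)
    R-edge y w h with ∨-true (adj B y w) _ (trans (sym (adj-++ B _ y w)) h)
    ... | inj₁ hB = inj₁ hB
    ... | inj₂ hE with adj-edge _ y w hE
    ...   | e , e∈ , j = inj₂ (e , ear-edge e∈ , j)

    B⊆R : ∀ y w → adj B y w ≡ true → adj R y w ≡ true
    B⊆R y w h = trans (adj-++ B _ y w) (cong (_∨ _) h)

    B⊆K : ∀ y w → adj B y w ≡ true → adj K y w ≡ true
    B⊆K y w h = trans (adj-++ B _ y w) (cong (_∨ _) h)

    CR CK : ℕ → ℕ → Set
    CR = Conn (adj R) V
    CK = Conn (adj K) V

    -- R-connectivity between low vertices is K-connectivity.  From R to K: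
    -- retract a and b onto low vertices so that each ear edge becomes a
    -- K-chain.
    ra rb : ℕ
    ra = if β₃ then q else p
    rb = if β₄ then ra else p

    retract : ℕ → ℕ
    retract x = if x ≡ᵇ a then ra else (if x ≡ᵇ b then rb else x)

    retract-low : ∀ {x} → x ≤ c → retract x ≡ x
    retract-low {x} x≤c rewrite ≢⇒≡ᵇ-false x a (low≢a x≤c) | ≢⇒≡ᵇ-false x b (low≢b x≤c) = refl

    retract-a : retract a ≡ ra
    retract-a rewrite ≡ᵇ-refl c = refl

    retract-b : retract b ≡ rb
    retract-b rewrite ≢⇒≡ᵇ-false b a (a≢b ∘ sym) | ≡ᵇ-refl c = refl

    Both : ℕ → ℕ → Set
    Both x y = CK x y × CK y x

    both-refl : ∀ {x} → Both x x
    both-refl = done , done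

    pq-K : joined ≡ true → Both p q
    pq-K h = single (low∈V q≤c) (adj-∈ K pq∈) , single (low∈V p≤c) (adj-∈ʳ K pq∈)
      where
      pq∈ : (p , q) ∈ K
      pq∈ = ∈-++⁺ʳ B (sel-∈ _ _ h)

    ear-retract : ∀ {e} → EarEdge e → Both (retract (proj₁ e)) (retract (proj₂ e))
    ear-retract (pa h) rewrite retract-low p≤c | retract-a =
      if-cases β₃ {Both p} (λ h₃ → pq-K (earJoins-via-a β₁ β₂ β₃ β₄ h h₃)) (λ _ → both-refl)
    ear-retract (pb h) rewrite retract-low p≤c | retract-b =
      if-cases β₄ {Both p}
        (λ h₄ → if-cases β₃ {Both p} (λ h₃ → pq-K (earJoins-via-b β₁ β₂ β₃ β₄ h h₃ h₄)) (λ _ → both-refl))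
        (λ _ → both-refl)
    ear-retract (qa refl) rewrite retract-low q≤c | retract-a = both-refl
    ear-retract (ab refl) rewrite retract-a | retract-b = both-refl

    retract-step : ∀ y w → w ∈ V → adj R y w ≡ true → CK (retract y) (retract w)
    retract-step y w w∈ h with R-edge y w h
    ... | inj₁ hB with B-adj-low y w hB
    ...   | y≤c , w≤c rewrite retract-low y≤c | retract-low w≤c = single w∈ (B⊆K y w hB)
    retract-step y w w∈ h | inj₂ (e , ee , inj₁ (refl , refl)) = proj₁ (ear-retract ee)
    retract-step y w w∈ h | inj₂ (e , ee , inj₂ (refl , refl)) = proj₂ (ear-retract ee)

    R⇒K : ∀ {v u} → v ≤ c → u ≤ c → CR v u → CK v u
    R⇒K {v} {u} v≤c u≤c cr = subst (CK v) (retract-low u≤c)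
      (conn-invariant (λ y → CK v (retract y)) (λ y w w∈ h ih → conn-trans ih (retract-step y w w∈ h)) cr
                      (subst (CK v) (sym (retract-low v≤c)) done))

    -- From K to R: the edge pq of K is a path through the ear.
    pq-R : joined ≡ true → CR p q × CR q p
    pq-R h with earJoins-cases β₁ β₂ β₃ β₄ h
    ... | inj₁ (h₁ , h₃) =
      conn-trans (single a∈V (adj-∈ R (pa∈ h₁))) (single (low∈V q≤c) (adj-∈ʳ R (qa∈ h₃))) ,
      conn-trans (single a∈V (adj-∈ R (qa∈ h₃))) (single (low∈V p≤c) (adj-∈ʳ R (pa∈ h₁)))
    ... | inj₂ (h₂ , h₃ , h₄) =
      conn-trans (single b∈V (adj-∈ R (pb∈ h₂)))
        (conn-trans (single a∈V (adj-∈ʳ R (ab∈ h₄))) (single (low∈V q≤c) (adj-∈ʳ R (qa∈ h₃)))) ,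
      conn-trans (single a∈V (adj-∈ R (qa∈ h₃)))
        (conn-trans (single b∈V (adj-∈ R (ab∈ h₄))) (single (low∈V p≤c) (adj-∈ʳ R (pb∈ h₂))))

    K⇒R : ∀ {v u} → CK v u → CR v u
    K⇒R = conn-map K-step
      where
      K-step : ∀ y w → w ∈ V → adj K y w ≡ true → CR y w
      K-step y w w∈ h with ∨-true (adj B y w) _ (trans (sym (adj-++ B _ y w)) h)
      ... | inj₁ hB = single w∈ (B⊆R y w hB)
      ... | inj₂ hpq with joined in jn
      ...   | true with adj-edge ((p , q) ∷ []) y w hpq
      ...     | _ , here refl , inj₁ (refl , refl) = proj₁ (pq-R jn)
      ...     | _ , here refl , inj₂ (refl , refl) = proj₂ (pq-R jn)

    AtA : ℕ → Set
    AtA y = y ≡ a ⊎ (y ≡ b × β₂ ≡ false)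

    stay-at-a : β₁ ≡ false → β₃ ≡ false → (β₄ ≡ true → β₂ ≡ false) →
                ∀ y w → w ∈ V → adj R y w ≡ true → AtA y → AtA w
    stay-at-a f₁ f₃ f₄₂ y w _ h at with R-edge y w h | at
    ... | inj₁ hB | inj₁ refl = ⊥-elim (1+n≰n (proj₁ (B-adj-low y w hB)))
    ... | inj₁ hB | inj₂ (refl , _) = ⊥-elim (low≢b (proj₁ (B-adj-low y w hB)) refl)
    ... | inj₂ (_ , pa h₁ , _) | _ = ⊥-elim (bit-clash h₁ f₁)
    ... | inj₂ (_ , qa h₃ , _) | _ = ⊥-elim (bit-clash h₃ f₃)
    ... | inj₂ (_ , pb _ , inj₁ (p≡y , _)) | inj₁ refl = ⊥-elim (low≢a p≤c p≡y)
    ... | inj₂ (_ , pb _ , inj₁ (p≡y , _)) | inj₂ (refl , _) = ⊥-elim (low≢b p≤c p≡y)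
    ... | inj₂ (_ , pb _ , inj₂ (_ , b≡y)) | inj₁ refl = ⊥-elim (a≢b (sym b≡y))
    ... | inj₂ (_ , pb h₂ , inj₂ _) | inj₂ (_ , f₂) = ⊥-elim (bit-clash h₂ f₂)
    ... | inj₂ (_ , ab h₄ , inj₁ (_ , refl)) | _ = inj₂ (refl , f₄₂ h₄)
    ... | inj₂ (_ , ab _ , inj₂ (refl , _)) | _ = inj₁ refl

    reach-R : ∀ {v u} → CR v u → reach (length V) V R v u ≡ true
    reach-R = conn⇒reach V R

    below : ∀ {v u} → u ∈ V → u < v → CR v u → joinedBelow V R v ≡ true
    below {v} u∈ u<v cr = any-∈ (belowTest V R v) u∈ (cong₂ _∧_ (<⇒<ᵇ′ u<v) (reach-R cr))

    below-witness : ∀ v → joinedBelow V R v ≡ true → ∃[ u ] (u < v × CR v u)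
    below-witness v h with any-witness (belowTest V R v) V h
    ... | u , _ , hu = u , <ᵇ⇒<′ u v (proj₁ (∧-true _ _ hu)) , reach⇒conn V R v u (proj₂ (∧-true _ _ hu))

    p<a : p < a
    p<a = s≤s p≤c

    a-joined : joinedBelow V R a ≡ earReachesA β₁ β₂ β₃ β₄
    a-joined = true-iff to from
      where
      from : earReachesA β₁ β₂ β₃ β₄ ≡ true → joinedBelow V R a ≡ true
      from h with earReachesA-cases β₁ β₂ β₃ β₄ h
      ... | inj₁ h₁ = below (low∈V p≤c) p<a (single (low∈V p≤c) (adj-∈ʳ R (pa∈ h₁)))
      ... | inj₂ (inj₁ h₃) = below (low∈V q≤c) (s≤s q≤c) (single (low∈V q≤c) (adj-∈ʳ R (qa∈ h₃)))
      ... | inj₂ (inj₂ (h₂ , h₄)) = below (low∈V p≤c) p<a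
            (conn-trans (single b∈V (adj-∈ R (ab∈ h₄))) (single (low∈V p≤c) (adj-∈ʳ R (pb∈ h₂))))
      below-a : ∀ {u} → u < a → AtA u → ⊥
      below-a u<a (inj₁ refl)       = <-irrefl refl u<a
      below-a u<a (inj₂ (refl , _)) = <-asym u<a (n<1+n a)
      to : joinedBelow V R a ≡ true → earReachesA β₁ β₂ β₃ β₄ ≡ true
      to h = not-false λ e →
        let u , u<a , cr   = below-witness a h
            f₁ , f₃ , f₄₂ = earReachesA-false β₁ β₂ β₃ β₄ e
        in below-a u<a (conn-invariant AtA (stay-at-a f₁ f₃ f₄₂) cr (inj₁ refl))

    stay-at-b : β₂ ≡ false → β₄ ≡ false → ∀ y w → w ∈ V → adj R y w ≡ true → y ≡ b → w ≡ b
    stay-at-b f₂ f₄ y w _ h refl with R-edge y w h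
    ... | inj₁ hB = ⊥-elim (low≢b (proj₁ (B-adj-low y w hB)) refl)
    ... | inj₂ (_ , pa _ , inj₁ (p≡b , _)) = ⊥-elim (low≢b p≤c p≡b)
    ... | inj₂ (_ , pa _ , inj₂ (_ , a≡b)) = ⊥-elim (a≢b a≡b)
    ... | inj₂ (_ , qa _ , inj₁ (q≡b , _)) = ⊥-elim (low≢b q≤c q≡b)
    ... | inj₂ (_ , qa _ , inj₂ (_ , a≡b)) = ⊥-elim (a≢b a≡b)
    ... | inj₂ (_ , pb h₂ , _) = ⊥-elim (bit-clash h₂ f₂)
    ... | inj₂ (_ , ab h₄ , _) = ⊥-elim (bit-clash h₄ f₄)

    b-joined : joinedBelow V R b ≡ β₂ ∨ β₄
    b-joined = true-iff to from
      where
      from : β₂ ∨ β₄ ≡ true → joinedBelow V R b ≡ true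
      from h with ∨-true β₂ β₄ h
      ... | inj₁ h₂ = below (low∈V p≤c) (≤-trans p<a (n≤1+n a)) (single (low∈V p≤c) (adj-∈ʳ R (pb∈ h₂)))
      ... | inj₂ h₄ = below a∈V (n<1+n a) (single a∈V (adj-∈ʳ R (ab∈ h₄)))
      to : joinedBelow V R b ≡ true → β₂ ∨ β₄ ≡ true
      to h = not-false λ e →
        let u , u<b , cr = below-witness b h
            f₂ , f₄     = ∨-false β₂ β₄ e
        in <-irrefl (conn-invariant (_≡ b) (stay-at-b f₂ f₄) cr refl) u<b

  vertex-cases : ∀ {v} → v ∈ V → v ≤ c ⊎ v ≡ a ⊎ v ≡ b
  vertex-cases v∈ with m≤n⇒m<n∨m≡n (≤-pred (∈-upTo⁻ v∈))
  ... | inj₂ v≡b = inj₂ (inj₂ v≡b)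
  ... | inj₁ v<b with m≤n⇒m<n∨m≡n (≤-pred v<b)
  ...   | inj₂ v≡a = inj₂ (inj₁ v≡a)
  ...   | inj₁ v<a = inj₁ (≤-pred v<a)

  twist : ∀ β p q → p ≤ c → q ≤ c → ncomp V (B ++ pick β (ear c p q)) ≡ ncomp V (B ++ pick β (ear c q p))
  twist β p q p≤c q≤c = ncomp-cong V L.R L′.R same-below
    where
    β₁ β₂ β₃ β₄ : Bool
    β₁ = headBit β
    β₂ = headBit (tailBits β)
    β₃ = headBit (tailBits (tailBits β))
    β₄ = headBit (tailBits (tailBits (tailBits β)))
    module L  = Attached p q p≤c q≤c β₁ β₂ β₃ β₄
    module L′ = Attached q p q≤c p≤c β₁ β₂ β₃ β₄

    swap-K : ∀ {x y v u} → Conn (adj (contracted L.joined x y)) V v u →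
             Conn (adj (contracted L.joined y x)) V v u
    swap-K {x} {y} = conn-map (λ y′ w w∈ h → single w∈ (trans (sym (contracted-sym L.joined x y y′ w)) h))

    -- Between low vertices both graphs have the connectivity of the contraction.
    same-low : ∀ {v u} → v ≤ c → u < v → reach (length V) V L.R v u ≡ reach (length V) V L′.R v u
    same-low {v} {u} v≤c u<v = true-iff
      (λ h → L′.reach-R (L′.K⇒R (swap-K (L.R⇒K v≤c u≤c (reach⇒conn V L.R v u h)))))
      (λ h → L.reach-R (L.K⇒R (swap-K (L′.R⇒K v≤c u≤c (reach⇒conn V L′.R v u h)))))
      where
      u≤c : u ≤ c
      u≤c = <⇒≤ (<-≤-trans u<v v≤c)

    same-below : ∀ v → v ∈ V → joinedBelow V L.R v ≡ joinedBelow V L′.R v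
    same-below v v∈ with vertex-cases v∈
    ... | inj₂ (inj₁ refl) = trans L.a-joined (sym L′.a-joined)
    ... | inj₂ (inj₂ refl) = trans L.b-joined (sym L′.b-joined)
    ... | inj₁ v≤c = any-cong (belowTest V L.R v) (belowTest V L′.R v) V (λ u _ → same-term u)
      where
      same-term : ∀ u → (u <ᵇ v) ∧ reach (length V) V L.R v u ≡ (u <ᵇ v) ∧ reach (length V) V L′.R v u
      same-term u with u <ᵇ v in u<v
      ... | false = refl
      ... | true  = same-low v≤c (<ᵇ⇒<′ u v u<v)

-- The Tutte summand of A ⊆ E(G).  It only depends on |V(G)|, k(G), k(V(G),A)
-- and |A|.  It is kept opaque: unfolding it while comparing summands would
-- evaluate component counts.

tutteTermOf : ℕ → ℕ → ℕ → ℕ → ℕ → ℕ → ℤ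
tutteTermOf i j nv k₀ k ℓ = coefPowMinusOne ((nv ∸ k₀) ∸ (nv ∸ k)) i ℤ.* coefPowMinusOne (ℓ ∸ (nv ∸ k)) j

opaque
  tutteTerm : Graph → ℕ → ℕ → List (ℕ × ℕ) → ℤ
  tutteTerm G i j A = tutteTermOf i j (nV G) (ncomp (vertices G) (E G)) (ncomp (vertices G) A) (length A)

opaque
  unfolding tutteTerm

  Tcoef-ΣS : ∀ G i j → Tcoef G i j ≡ ΣS (tutteTerm G i j) (E G)
  Tcoef-ΣS G i j = refl

  tutteTerm-cong : ∀ G G′ i j A A′ → nV G ≡ nV G′ → ncomp (vertices G) (E G) ≡ ncomp (vertices G′) (E G′) →
                   ncomp (vertices G) A ≡ ncomp (vertices G′) A′ → length A ≡ length A′ →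
                   tutteTerm G i j A ≡ tutteTerm G′ i j A′
  tutteTerm-cong G G′ i j A A′ eN eK₀ eK eL = cong₄ eN eK₀ eK eL
    where
    cong₄ : ∀ {nv nv′ k₀ k₀′ k k′ ℓ ℓ′} → nv ≡ nv′ → k₀ ≡ k₀′ → k ≡ k′ → ℓ ≡ ℓ′ →
            tutteTermOf i j nv k₀ k ℓ ≡ tutteTermOf i j nv′ k₀′ k′ ℓ′
    cong₄ refl refl refl refl = refl

  tutteTerm-↭ : ∀ G i j → PermInvariant (tutteTerm G i j)
  tutteTerm-↭ G i j {A} {A′} A↭A′ =
    cong₂ (tutteTermOf i j (nV G) (ncomp (vertices G) (E G)))
          (ncomp-↭ (vertices G) A A′ A↭A′) (Perm.↭-length A↭A′)

spoke rim : ℕ → ℕ × ℕ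
spoke i = (0 , suc i)
rim   i = (suc i , suc (suc i))

fanEdges-cases : ∀ n {e} → e ∈ fanEdges n →
                 (∃[ i ] (i < n × e ≡ spoke i)) ⊎ (∃[ i ] (i < n ∸ 1 × e ≡ rim i))
fanEdges-cases n e∈ with ∈-++⁻ (map spoke (upTo n)) e∈
... | inj₁ e∈s with ∈-map⁻ spoke e∈s
...   | i , i∈ , refl = inj₁ (i , ∈-upTo⁻ i∈ , refl)
fanEdges-cases n e∈ | inj₂ e∈r with ∈-map⁻ rim e∈r
...   | i , i∈ , refl = inj₂ (i , ∈-upTo⁻ i∈ , refl)

fanEdges-low : ∀ n e → e ∈ fanEdges n → proj₁ e ≤ n × proj₂ e ≤ n
fanEdges-low n e e∈ with fanEdges-cases n e∈
... | inj₁ (i , i<n , refl) = z≤n , i<n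
fanEdges-low (suc n) e e∈ | inj₂ (i , i<n , refl) = <⇒≤ (s≤s i<n) , s≤s i<n

fanEdges-up : ∀ n e → e ∈ fanEdges n → proj₁ e < proj₂ e
fanEdges-up n e e∈ with fanEdges-cases n e∈
... | inj₁ (i , _ , refl) = s≤s z≤n
... | inj₂ (i , _ , refl) = n<1+n (suc i)

fan-adj-shape : ∀ n u w → adj (fanEdges n) u w ≡ true → u ≡ 0 ⊎ w ≡ 0 ⊎ w ≡ suc u ⊎ u ≡ suc w
fan-adj-shape n u w h with adj-edge (fanEdges n) u w h
... | e , e∈ , j with fanEdges-cases n e∈ | j
...   | inj₁ (_ , _ , refl) | inj₁ (refl , _) = inj₁ refl
...   | inj₁ (_ , _ , refl) | inj₂ (refl , _) = inj₂ (inj₁ refl)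
...   | inj₂ (_ , _ , refl) | inj₁ (refl , refl) = inj₂ (inj₂ (inj₁ refl))
...   | inj₂ (_ , _ , refl) | inj₂ (refl , refl) = inj₂ (inj₂ (inj₂ refl))

map-upTo-suc : ∀ {A : Set} (f : ℕ → A) m → map f (upTo (suc m)) ≡ map f (upTo m) ++ f m ∷ []
map-upTo-suc f m = trans (cong (map f) (sym (upTo-∷ʳ m))) (map-++ f (upTo m) (m ∷ []))

map-upTo-2 : ∀ {A : Set} (f : ℕ → A) m → map f (upTo (suc (suc m))) ≡ map f (upTo m) ++ f m ∷ f (suc m) ∷ []
map-upTo-2 f m = begin
  map f (upTo (suc (suc m)))                  ≡⟨ map-upTo-suc f (suc m) ⟩
  map f (upTo (suc m)) ++ f (suc m) ∷ []      ≡⟨ cong (_++ f (suc m) ∷ []) (map-upTo-suc f m) ⟩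
  (map f (upTo m) ++ f m ∷ []) ++ f (suc m) ∷ [] ≡⟨ List.++-assoc (map f (upTo m)) _ _ ⟩
  map f (upTo m) ++ f m ∷ f (suc m) ∷ []      ∎
  where open ≡-Reasoning

↭-interchange : ∀ {A : Set} (W X Y Z : List A) → (W ++ X) ++ (Y ++ Z) ↭ (W ++ Y) ++ (X ++ Z)
↭-interchange W X Y Z =
  ↭.↭-trans (↭.↭-reflexive (List.++-assoc W X (Y ++ Z)))
    (↭.↭-trans (Perm.++⁺ˡ W (Perm.shifts X Y))
      (↭.↭-reflexive (sym (List.++-assoc W Y (X ++ Z)))))

module FanEars (k : ℕ) where

  c : ℕ
  c = suc k

  fan-ear : E (fan (suc (suc c))) ↭ fanEdges c ++ ear c 0 c
  fan-ear = ↭.↭-trans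
    (↭.↭-reflexive (cong₂ _++_ (map-upTo-2 spoke c) (map-upTo-2 rim k)))
    (↭-interchange (map spoke (upTo c)) _ (map rim (upTo k)) _)

  fanPlus-ear : E (fanPlus (suc (suc c))) ↭ fanEdges c ++ ear c c 0
  fanPlus-ear = ↭.↭-trans
    (↭.↭-reflexive (cong (_++ (c , suc (suc c)) ∷ (suc c , suc (suc c)) ∷ [])
                         (cong₂ _++_ (map-upTo-suc spoke c) (map-upTo-suc rim k))))
    (↭.↭-trans (Perm.++⁺ʳ _ (↭-interchange (map spoke (upTo c)) _ (map rim (upTo k)) _))
    (↭.↭-trans (↭.↭-reflexive (List.++-assoc (fanEdges c) _ _))
               (Perm.++⁺ˡ (fanEdges c) (↭.↭-trans (↭.swap _ _ ↭.refl) (↭.prep _ (↭.swap _ _ ↭.refl))))))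



  F P : Graph
  F = fan (suc (suc c))
  P = fanPlus (suc (suc c))

  D : List (ℕ × ℕ)
  D = fanEdges c

  same-length : length (D ++ ear c 0 c) ≡ length (D ++ ear c c 0)
  same-length = trans (List.length-++ D) (sym (List.length-++ D))

  -- Subsets of F and of F⁺ selected at corresponding positions have equally
  -- many components: they agree on the fan F_c and differ by a twisted ear.
  twist-subset : ∀ β → ncomp (vertices F) (pick β (D ++ ear c 0 c)) ≡ ncomp (vertices P) (pick β (D ++ ear c c 0))
  twist-subset β = begin
    ncomp (vertices F) (pick β (D ++ ear c 0 c))
      ≡⟨ ncomp-at (vertices F) T.V (pick β (D ++ ear c 0 c)) (Bβ ++ pick β′ (ear c 0 c)) refl (pick-++ β D (ear c 0 c)) ⟩
    ncomp T.V (Bβ ++ pick β′ (ear c 0 c))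
      ≡⟨ T.twist β′ 0 c z≤n ≤-refl ⟩
    ncomp T.V (Bβ ++ pick β′ (ear c c 0))
      ≡⟨ ncomp-at T.V (vertices P) (Bβ ++ pick β′ (ear c c 0)) (pick β (D ++ ear c c 0)) refl (sym (pick-++ β D (ear c c 0))) ⟩
    ncomp (vertices P) (pick β (D ++ ear c c 0))
      ∎
    where
    open ≡-Reasoning
    Bβ : List (ℕ × ℕ)
    Bβ = pick β D
    β′ : List Bool
    β′ = dropBits (length D) β
    module T = Twist c Bβ (λ e e∈ → fanEdges-low c e (pick-⊆ β D e∈))

  -- In particular (selecting everything) F and F⁺ have equally many components.
  same-components : ncomp (vertices F) (E F) ≡ ncomp (vertices P) (E P)
  same-components = begin
    ncomp (vertices F) (E F)
      ≡⟨ ncomp-↭ (vertices F) (E F) (D ++ ear c 0 c) fan-ear ⟩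
    ncomp (vertices F) (D ++ ear c 0 c)
      ≡⟨ ncomp-at (vertices F) (vertices F) (D ++ ear c 0 c) (pick all (D ++ ear c 0 c)) refl (sym (pick-all (D ++ ear c 0 c))) ⟩
    ncomp (vertices F) (pick all (D ++ ear c 0 c))
      ≡⟨ twist-subset all ⟩
    ncomp (vertices P) (pick all (D ++ ear c c 0))
      ≡⟨ ncomp-at (vertices P) (vertices P) (pick all (D ++ ear c c 0)) (D ++ ear c c 0) refl (pick-all′ (D ++ ear c 0 c) (D ++ ear c c 0) same-length) ⟩
    ncomp (vertices P) (D ++ ear c c 0)
      ≡⟨ ncomp-↭ (vertices P) (D ++ ear c c 0) (E P) (↭.↭-sym fanPlus-ear) ⟩
    ncomp (vertices P) (E P)
      ∎
    where
    open ≡-Reasoning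
    all : List Bool
    all = replicate (length (D ++ ear c 0 c)) true

  tutte-equal : ∀ i j → Tcoef F i j ≡ Tcoef P i j
  tutte-equal i j = begin
    Tcoef F i j                           ≡⟨ Tcoef-ΣS F i j ⟩
    ΣS (tutteTerm F i j) (E F)            ≡⟨ ΣS-↭ (tutteTerm F i j) (tutteTerm-↭ F i j) fan-ear ⟩
    ΣS (tutteTerm F i j) (D ++ ear c 0 c)
      ≡⟨ ΣS-positions (tutteTerm F i j) (tutteTerm P i j) (D ++ ear c 0 c) (D ++ ear c c 0) same-length same-term ⟩
    ΣS (tutteTerm P i j) (D ++ ear c c 0) ≡⟨ ΣS-↭ (tutteTerm P i j) (tutteTerm-↭ P i j) (↭.↭-sym fanPlus-ear) ⟩
    ΣS (tutteTerm P i j) (E P)            ≡⟨ sym (Tcoef-ΣS P i j) ⟩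
    Tcoef P i j                           ∎
    where
    open ≡-Reasoning
    same-term : ∀ β → tutteTerm F i j (pick β (D ++ ear c 0 c)) ≡ tutteTerm P i j (pick β (D ++ ear c c 0))
    same-term β = tutteTerm-cong F P i j (pick β (D ++ ear c 0 c)) (pick β (D ++ ear c c 0))
                    refl same-components (twist-subset β) (pick-length β (D ++ ear c 0 c) (D ++ ear c c 0) same-length)

  b : ℕ
  b = suc (suc c)

  adj-P : ∀ {e u w} → e ∈ D ++ ear c c 0 → Joins e u w → adj (E P) u w ≡ true
  adj-P {u = u} {w} e∈ j = trans (adj-↭ fanPlus-ear u w) (adj-joins (D ++ ear c c 0) e∈ j)

  F-edge : ∀ u w → adj (E F) u w ≡ true → adj (E P) u w ≡ true ⊎ Joins (0 , b) u w
  F-edge u w h with adj-edge (D ++ ear c 0 c) u w (trans (sym (adj-↭ fan-ear u w)) h)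
  ... | e , e∈ , j with ∈-++⁻ D e∈
  ...   | inj₁ e∈D                            = inj₁ (adj-P (∈-++⁺ˡ e∈D) j)
  ...   | inj₂ (here refl)                    = inj₁ (adj-P (∈-++⁺ʳ D (there (there (here refl)))) j)
  ...   | inj₂ (there (here refl))            = inj₂ j
  ...   | inj₂ (there (there (here refl)))    = inj₁ (adj-P (∈-++⁺ʳ D (here refl)) j)
  ...   | inj₂ (there (there (there (here refl)))) = inj₁ (adj-P (∈-++⁺ʳ D (there (there (there (here refl))))) j)

  centre-P : ∀ t → 0 < t → t < b → adj (E P) 0 t ≡ true
  centre-P (suc i) _ (s≤s i<a) with m≤n⇒m<n∨m≡n (≤-pred i<a)
  ... | inj₁ i<c  = adj-P (∈-++⁺ˡ (∈-++⁺ˡ (∈-map⁺ spoke (∈-upTo⁺ i<c)))) (inj₁ (refl , refl))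
  ... | inj₂ refl = adj-P (∈-++⁺ʳ D (there (there (here refl)))) (inj₁ (refl , refl))

  cb-P : adj (E P) c b ≡ true
  cb-P = adj-P (∈-++⁺ʳ D (there (here refl))) (inj₁ (refl , refl))

sublists-⊆ : ∀ {A : Set} (L : List A) {X} → X ∈ sublists L → X ⊆ L
sublists-⊆ []      (here refl) = []
sublists-⊆ (x ∷ L) X∈ with ∈-++⁻ (sublists L) X∈
... | inj₁ X∈′ = x ∷ʳ sublists-⊆ L X∈′
... | inj₂ X∈″ with ∈-map⁻ (x ∷_) X∈″
...   | X′ , X′∈ , refl = refl ∷ sublists-⊆ L X′∈

⊆-sublists : ∀ {A : Set} {X L : List A} → X ⊆ L → X ∈ sublists L
⊆-sublists []         = here refl
⊆-sublists (y ∷ʳ τ)   = ∈-++⁺ˡ (⊆-sublists τ)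
⊆-sublists {L = y ∷ L} (refl ∷ τ) = ∈-++⁺ʳ (sublists L) (∈-map⁺ (y ∷_) (⊆-sublists τ))

unique-⊆ : ∀ {A : Set} {X L : List A} → X ⊆ L → Unique L → Unique X
unique-⊆ []         []         = []
unique-⊆ (_ ∷ʳ τ)   (_ ∷ uL)   = unique-⊆ τ uL
unique-⊆ (refl ∷ τ) (x∉ ∷ uL)  = Sublist.All-resp-⊆ τ x∉ ∷ unique-⊆ τ uL

three-avoid : ∀ {x y z} s t → Unique (x ∷ y ∷ z ∷ []) → ∃[ w ] (w ∈ x ∷ y ∷ z ∷ [] × w ≢ s × w ≢ t)
three-avoid {x} {y} {z} s t ((x≢y ∷ x≢z ∷ []) ∷ (y≢z ∷ []) ∷ [] ∷ []) with x ≟ s | x ≟ t | y ≟ s | y ≟ t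
... | no x≢s | no x≢t | _ | _ = x , here refl , x≢s , x≢t
... | _ | _ | no y≢s | no y≢t = y , there (here refl) , y≢s , y≢t
... | yes refl | _ | yes refl | _ = ⊥-elim (x≢y refl)
... | _ | yes refl | _ | yes refl = ⊥-elim (x≢y refl)
... | yes refl | _ | _ | yes refl = z , there (there (here refl)) , x≢z ∘ sym , y≢z ∘ sym
... | _ | yes refl | yes refl | _ = z , there (there (here refl)) , y≢z ∘ sym , x≢z ∘ sym

-- The coefficient of x³y³ in Q counts the independent 3-sets.
indep3 : Graph → List ℕ → Bool
indep3 G X = (length X ≡ᵇ 3) ∧ (kInduced G X ≡ᵇ 3)

module Independent3 (m : ℕ) where

  open FanEars (suc (suc m))

  a : ℕ
  a = suc c

  indep3-transfer : ∀ X → X ∈ sublists (vertices P) → indep3 P X ≡ true → indep3 F X ≡ true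
  indep3-transfer []                    _ ()
  indep3-transfer (_ ∷ [])              _ ()
  indep3-transfer (_ ∷ _ ∷ [])          _ ()
  indep3-transfer (_ ∷ _ ∷ _ ∷ _ ∷ _)   _ ()
  indep3-transfer (x ∷ y ∷ z ∷ []) X∈ h =
    cong (λ k → true ∧ (k ≡ᵇ 3)) (ncomp-independent X (E F) F-free)
    where
    X : List ℕ
    X = x ∷ y ∷ z ∷ []
    uX : Unique X
    uX = unique-⊆ (sublists-⊆ (vertices P) X∈) (upTo⁺ _)
    in-range : ∀ {u} → u ∈ X → u < suc b
    in-range u∈ = ∈-upTo⁻ (Sublist.Any-resp-⊆ (sublists-⊆ (vertices P) X∈) u∈)
    P-free : ∀ {u w} → u ∈ X → w ∈ X → u ≢ w → adj (E P) u w ≡ false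
    P-free u∈ w∈ u≢w = not-true λ t →
      <-irrefl (≡ᵇ⇒≡′ _ 3 (proj₂ (∧-true _ _ h))) (ncomp-edge-< X (E P) u∈ w∈ u≢w t)
    centre-and-b : 0 ∈ X → b ∈ X → ⊥
    centre-and-b 0∈ b∈ =
      let t , t∈ , t≢0 , t≢b = three-avoid 0 b uX
      in bit-clash (centre-P t (n≢0⇒n>0 t≢0) (≤∧≢⇒< (≤-pred (in-range t∈)) t≢b))
                   (P-free 0∈ t∈ (t≢0 ∘ sym))
    F-edge-inside : ∀ {u w} → u ∈ X → w ∈ X → adj (E F) u w ≡ true → ⊥
    F-edge-inside {u} {w} u∈ w∈ t with u ≟ w
    ... | yes refl = bit-clash t (adj-irrefl (E F) (fanEdges-up (suc (suc c))) u)
    ... | no u≢w with F-edge u w t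
    ...   | inj₁ tP                  = bit-clash tP (P-free u∈ w∈ u≢w)
    ...   | inj₂ (inj₁ (refl , refl)) = centre-and-b u∈ w∈
    ...   | inj₂ (inj₂ (refl , refl)) = centre-and-b w∈ u∈
    F-free : ∀ u w → u ∈ X → w ∈ X → adj (E F) u w ≡ false
    F-free u w u∈ w∈ = not-true (F-edge-inside u∈ w∈)

  -- The witness {1, c, b}; it lies in V = upTo c ++ c ∷ a ∷ b ∷ [].
  W : List ℕ
  W = 1 ∷ c ∷ b ∷ []

  W⊆ : W ⊆ vertices F
  W⊆ = subst (W ⊆_) (upTo-∷ʳ b)
         (Sublist.++⁺ (subst (1 ∷ c ∷ [] ⊆_) (upTo-∷ʳ a)
                        (Sublist.++⁺ʳ (a ∷ []) (subst (1 ∷ c ∷ [] ⊆_) (upTo-∷ʳ c)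
                           (Sublist.++⁺ (from∈ (∈-upTo⁺ {c} (s≤s (s≤s z≤n)))) (refl ∷ [])))))
                      (refl ∷ []))

  -- No two vertices of W are the centre or consecutive, since c ≥ 3.
  W-positive : ∀ {u} → u ∈ W → u ≢ 0
  W-positive (here refl)                 ()
  W-positive (there (here refl))         ()
  W-positive (there (there (here refl))) ()

  W-apart : ∀ {u w} → u ∈ W → w ∈ W → w ≢ suc u
  W-apart (here refl)                 (here refl)                 ()
  W-apart (here refl)                 (there (here refl))         ()
  W-apart (here refl)                 (there (there (here refl))) ()
  W-apart (there (here refl))         (here refl)                 ()
  W-apart (there (here refl))         (there (here refl))         ()
  W-apart (there (here refl))         (there (there (here refl))) ()
  W-apart (there (there (here refl))) (here refl)                 ()
  W-apart (there (there (here refl))) (there (here refl))         ()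
  W-apart (there (there (here refl))) (there (there (here refl))) ()

  W-indep-F : indep3 F W ≡ true
  W-indep-F = cong (λ k → true ∧ (k ≡ᵇ 3)) (ncomp-independent W (E F) no-edge)
    where
    no-edge : ∀ u w → u ∈ W → w ∈ W → adj (E F) u w ≡ false
    no-edge u w u∈ w∈ = not-true λ t → case (fan-adj-shape (suc (suc c)) u w t)
      where
      case : u ≡ 0 ⊎ w ≡ 0 ⊎ w ≡ suc u ⊎ u ≡ suc w → ⊥
      case (inj₁ u≡0)               = W-positive u∈ u≡0
      case (inj₂ (inj₁ w≡0))        = W-positive w∈ w≡0
      case (inj₂ (inj₂ (inj₁ w≡u+1))) = W-apart u∈ w∈ w≡u+1
      case (inj₂ (inj₂ (inj₂ u≡w+1))) = W-apart w∈ u∈ u≡w+1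

  -- In F⁺ the edge cb lies inside W.
  W-not-indep-P : indep3 P W ≡ false
  W-not-indep-P = ≢⇒≡ᵇ-false (ncomp W (E P)) 3 (<⇒≢ (ncomp-edge-< W (E P) c∈ b∈ c≢b cb-P))
    where
    c∈ : c ∈ W
    c∈ = there (here refl)
    b∈ : b ∈ W
    b∈ = there (there (here refl))
    c≢b : c ≢ b
    c≢b ()

  Q33-< : Qcoef P 3 3 < Qcoef F 3 3
  Q33-< = count-mono-< (indep3 P) (indep3 F) (sublists (vertices P)) indep3-transfer
            (⊆-sublists W⊆) W-not-indep-P W-indep-F

  Q-differs : ¬ (∀ i j → Qcoef F i j ≡ Qcoef P i j)
  Q-differs same = <-irrefl (sym (same 3 3)) Q33-<

proposition5p1 : (n : ℕ) → 5 ≤ n →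
    ((i j : ℕ) → Tcoef (fan n) i j ≡ Tcoef (fanPlus n) i j)
    × ¬ ((i j : ℕ) → Qcoef (fan n) i j ≡ Qcoef (fanPlus n) i j)
proposition5p1 (suc (suc (suc (suc (suc m))))) (s≤s (s≤s (s≤s (s≤s (s≤s _))))) =
  FanEars.tutte-equal (suc (suc m)) , Independent3.Q-differs m
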